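{- For any $\vdash C : T$, for all $\vdash c : T^* \rightarrow o$, $BT(C^*~c) = ET(C)[\mathtt{return}(V) \leftarrow BT(c~V^*)]$.
   Context: EPCF is a fine-grained call-by-value calculus with finite ground types $\mathsf{B}$ (with a set $\mathcal{V}$ of constant values), finite enumeration types $\mathsf{k}$ inhabited by $\underline{0},\dots,\underline{k-1}$, function types, fixpoints $\mathtt{fix}~x.V$, computations $V~W$, $\mathtt{return}(V)$, $\mathtt{let}~x = C~\mathtt{in}~B$, $\mathtt{case}(V;C_1,\dots,C_k)$ and algebraic operations $\sigma(V;x.C)$ with $\sigma : \mathsf{B} \rightsquigarrow k$ in a signature $\Sigma$. The effect tree $ET(C)$ of a closed computation $\vdash C : T$ is obtained by reducing $C$: it is $\bot$ if $C$ diverges, $\mathtt{return}(V)$ if $C \rightarrow^* \mathtt{return}(V)$, and $\sigma(v, ET(C[x:=\underline{0}]),\dots,ET(C[x:=\underline{k-1}]))$ if $C \rightarrow^* \sigma(v;x.C)$ (so the parameter is an extra first child). $BT(M)$ denotes the Böhm tree of a closed ground $\lambda Y$-term $M$ under weak head reduction, over the signature $\{v : 0 \mid v \in \mathcal{V}\} \cup \{\sigma : k+1 \mid (\sigma : \mathsf{B} \rightsquigarrow k) \in \Sigma\}$. The CPS translation $(\cdot)^*$ is: on types, with $\neg T = T \rightarrow o$, $\mathsf{B}^* = o$, $\mathsf{k}^* = \neg o^k$, $(T \rightarrow U)^* = T^* \rightarrow \neg U^* \rightarrow o$; on terms, $v^* = v$, $x^* = x$, $\underline{n}^* = \lambda x_0,\dots,x_{k-1}.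 x_n$, $(\lambda x.C)^* = \lambda x. C^*$, $(\mathtt{fix}~x.V)^* = Y(\lambda x.V^*)$, $(V~W)^* = \lambda c. V^*~W^*~c$, $\mathtt{return}(V)^* = \lambda c. c~V^*$, $\mathtt{case}(V;C_1,\dots,C_k)^* = \lambda c. V^*~(C_1~c)\cdots(C_k~c)$, $(\mathtt{let}~x = C~\mathtt{in}~B)^* = \lambda c. C^*~(\lambda x. B^*~c)$, $\sigma(V;x.C)^* = \lambda c. \sigma~V^*~(C^*[x:=\underline{0}^*]~c)\cdots(C^*[x:=\underline{k-1}^*]~c)$. The notation $t[\mathtt{return}(V) \leftarrow BT(c~V^*)]$ means replacing each leaf $\mathtt{return}(V)$ of $t$ by the tree $BT(c~V^*)$. -}

module Defs where

open import Data.Nat using (ℕ; zero; suc; _≤_)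
open import Data.Fin using (Fin; zero; suc; toℕ)
open import Data.List using (List; []; _∷_; map)
open import Data.Empty using (⊥)
open import Data.Product using (Σ; _,_)
open import Relation.Nullary using (¬_)
open import Relation.Binary.PropositionalEquality using (_≡_)
open import Relation.Binary.Construct.Closure.ReflexiveTransitive using (Star)

-- Parameters of EPCF: ground types 𝖡 (each with a finite set of constant
-- values, here Fin (nval 𝖡)) and a signature Σ of algebraic operations
-- σ : 𝖡 ⇝ k  (par σ = 𝖡, ar σ = k).

record Sig : Set₁ where
  field
    Base : Set
    nval : Base → ℕ
    Op   : Set
    par  : Op → Base
    ar   : Op → ℕ

data _∋_ {T : Set} : List T → T → Set where
  here  : ∀ {x xs} → (x ∷ xs) ∋ x
  there : ∀ {x y xs} → xs ∋ x → (y ∷ xs) ∋ x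

module Theory (S : Sig) where
  open Sig S public

  -- Ranked trees (possibly infinite, possibly partial) over the signature
  --   { v : 0 | v ∈ 𝒱 } ∪ { σ : k+1 | (σ : 𝖡 ⇝ k) ∈ Σ }
  -- with ⊥ and extra leaves ret x (x : X) (used for return(V) in effect trees).

  data Sym : Set where
    symv : (b : Base) → Fin (nval b) → Sym
    symσ : Op → Sym

  arity : Sym → ℕ
  arity (symv _ _) = 0
  arity (symσ s)   = suc (ar s)

  -- A (possibly infinite, possibly partial) tree is given by its labelling
  -- of positions: a position is a path of child indices (0-based), and
  -- `none` marks positions that are not in the tree.
  data Label (X : Set) : Set where
    ⊥ℓ   : Label X
    retℓ : X → Label X
    symℓ : Sym → Label X
    none : Label X

  Path : Set
  Path = List ℕ

  Tree : Set → Set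
  Tree X = Path → Label X

  bind : ∀ {X Y} → Tree X → (X → Tree Y) → Tree Y
  bind t g [] with t []
  ... | ⊥ℓ     = ⊥ℓ
  ... | retℓ x = g x []
  ... | symℓ f = symℓ f
  ... | none   = none
  bind t g (i ∷ p) with t []
  ... | ⊥ℓ     = none
  ... | retℓ x = g x (i ∷ p)
  ... | symℓ f = bind (λ q → t (i ∷ q)) g p
  ... | none   = none

  infixr 5 _⇒_
  data LTy : Set where
    o   : LTy
    _⇒_ : LTy → LTy → LTy

  neg : LTy → LTy
  neg A = A ⇒ o

  os : ℕ → LTy
  os zero    = o
  os (suc n) = o ⇒ os n

  data Tm (Γ : List LTy) : LTy → Set where
    var : ∀ {A} → Γ ∋ A → Tm Γ A
    lam : ∀ {A B} → Tm (A ∷ Γ) B → Tm Γ (A ⇒ B)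
    app : ∀ {A B} → Tm Γ (A ⇒ B) → Tm Γ A → Tm Γ B
    Y   : ∀ {A} → Tm Γ ((A ⇒ A) ⇒ A)
    con : (b : Base) → Fin (nval b) → Tm Γ o
    opc : (s : Op) → Tm Γ (os (suc (ar s)))

  LRen : List LTy → List LTy → Set
  LRen Γ Δ = ∀ {A} → Γ ∋ A → Δ ∋ A

  lext : ∀ {Γ Δ B} → LRen Γ Δ → LRen (B ∷ Γ) (B ∷ Δ)
  lext ρ here      = here
  lext ρ (there x) = there (ρ x)

  lren : ∀ {Γ Δ A} → LRen Γ Δ → Tm Γ A → Tm Δ A
  lren ρ (var x)   = var (ρ x)
  lren ρ (lam M)   = lam (lren (lext ρ) M)
  lren ρ (app M N) = app (lren ρ M) (lren ρ N)
  lren ρ Y         = Y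
  lren ρ (con b v) = con b v
  lren ρ (opc s)   = opc s

  lwk : ∀ {Γ A B} → Tm Γ A → Tm (B ∷ Γ) A
  lwk = lren there

  lwk₁ : ∀ {Γ A B C} → Tm (A ∷ Γ) C → Tm (A ∷ B ∷ Γ) C
  lwk₁ = lren (lext there)

  LSub : List LTy → List LTy → Set
  LSub Γ Δ = ∀ {A} → Γ ∋ A → Tm Δ A

  lexts : ∀ {Γ Δ B} → LSub Γ Δ → LSub (B ∷ Γ) (B ∷ Δ)
  lexts σ here      = var here
  lexts σ (there x) = lwk (σ x)

  lsub : ∀ {Γ Δ A} → LSub Γ Δ → Tm Γ A → Tm Δ A
  lsub σ (var x)   = σ x
  lsub σ (lam M)   = lam (lsub (lexts σ) M)
  lsub σ (app M N) = app (lsub σ M) (lsub σ N)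
  lsub σ Y         = Y
  lsub σ (con b v) = con b v
  lsub σ (opc s)   = opc s

  lσ₀ : ∀ {Γ B} → Tm Γ B → LSub (B ∷ Γ) Γ
  lσ₀ N here      = N
  lσ₀ N (there x) = var x

  _[_]ₗ : ∀ {Γ A B} → Tm (B ∷ Γ) A → Tm Γ B → Tm Γ A
  M [ N ]ₗ = lsub (lσ₀ N) M

  apps : ∀ {Γ n} → Tm Γ (os n) → (Fin n → Tm Γ o) → Tm Γ o
  apps {n = zero}  h Ms = h
  apps {n = suc n} h Ms = apps (app h (Ms zero)) (λ i → Ms (suc i))

  symTm : ∀ {Γ} (f : Sym) → Tm Γ (os (arity f))
  symTm (symv b v) = con b v
  symTm (symσ s)   = opc s

  infix 4 _↦_ _↦*_
  data _↦_ {Γ} : ∀ {A} → Tm Γ A → Tm Γ A → Set where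
    β  : ∀ {A B} {M : Tm (A ∷ Γ) B} {N} → app (lam M) N ↦ M [ N ]ₗ
    δY : ∀ {A} {M : Tm Γ (A ⇒ A)} → app Y M ↦ app M (app Y M)
    ξ  : ∀ {A B} {M M' : Tm Γ (A ⇒ B)} {N} → M ↦ M' → app M N ↦ app M' N

  _↦*_ : ∀ {Γ A} → Tm Γ A → Tm Γ A → Set
  _↦*_ = Star _↦_

  data HNF : Tm [] o → Set where
    hnf : (f : Sym) (Ms : Fin (arity f) → Tm [] o) → HNF (apps (symTm f) Ms)

  NoHNF : Tm [] o → Set
  NoHNF M = ∀ M' → M ↦* M' → ¬ HNF M'

  -- BTAt M p ℓ  ⇔  the label of BT(M) at position p is ℓ
  data BTAt (M : Tm [] o) : Path → Label ⊥ → Set where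
    bt-bot   : NoHNF M → BTAt M [] ⊥ℓ
    bt-bot↓  : ∀ {i p} → NoHNF M → BTAt M (i ∷ p) none
    bt-head  : ∀ {f Ms} → M ↦* apps (symTm f) Ms → BTAt M [] (symℓ f)
    bt-child : ∀ {f Ms p ℓ} → M ↦* apps (symTm f) Ms →
               (j : Fin (arity f)) → BTAt (Ms j) p ℓ → BTAt M (toℕ j ∷ p) ℓ
    bt-out   : ∀ {f Ms i p} → M ↦* apps (symTm f) Ms →
               arity f ≤ i → BTAt M (i ∷ p) none

  IsBT : Tm [] o → Tree ⊥ → Set
  IsBT M t = ∀ p → BTAt M p (t p)

  infixr 5 _⇛_
  data Ty : Set where
    gty : Base → Ty
    enm : ℕ → Ty
    _⇛_ : Ty → Ty → Ty

  data Val (Γ : List Ty) : Ty → Set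
  data Comp (Γ : List Ty) : Ty → Set

  data Val Γ where
    vvar : ∀ {T} → Γ ∋ T → Val Γ T
    vcon : (b : Base) → Fin (nval b) → Val Γ (gty b)
    num  : ∀ {k} → Fin k → Val Γ (enm k)
    vlam : ∀ {T U} → Comp (T ∷ Γ) U → Val Γ (T ⇛ U)
    vfix : ∀ {T U} → Val ((T ⇛ U) ∷ Γ) (T ⇛ U) → Val Γ (T ⇛ U)

  data Comp Γ where
    capp  : ∀ {T U} → Val Γ (T ⇛ U) → Val Γ T → Comp Γ U
    cret  : ∀ {T} → Val Γ T → Comp Γ T
    clet  : ∀ {T U} → Comp Γ T → Comp (T ∷ Γ) U → Comp Γ U
    ccase : ∀ {k T} → Val Γ (enm k) → (Fin k → Comp Γ T) → Comp Γ T
    cop   : ∀ {T} (s : Op) → Val Γ (gty (par s)) → Comp (enm (ar s) ∷ Γ) T → Comp Γ T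

  Ren : List Ty → List Ty → Set
  Ren Γ Δ = ∀ {T} → Γ ∋ T → Δ ∋ T

  ext : ∀ {Γ Δ U} → Ren Γ Δ → Ren (U ∷ Γ) (U ∷ Δ)
  ext ρ here      = here
  ext ρ (there x) = there (ρ x)

  renV : ∀ {Γ Δ T} → Ren Γ Δ → Val Γ T → Val Δ T
  renC : ∀ {Γ Δ T} → Ren Γ Δ → Comp Γ T → Comp Δ T
  renV ρ (vvar x)   = vvar (ρ x)
  renV ρ (vcon b v) = vcon b v
  renV ρ (num i)    = num i
  renV ρ (vlam C)   = vlam (renC (ext ρ) C)
  renV ρ (vfix V)   = vfix (renV (ext ρ) V)
  renC ρ (capp V W)    = capp (renV ρ V) (renV ρ W)
  renC ρ (cret V)      = cret (renV ρ V)
  renC ρ (clet C B)    = clet (renC ρ C) (renC (ext ρ) B)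
  renC ρ (ccase V Cs)  = ccase (renV ρ V) (λ i → renC ρ (Cs i))
  renC ρ (cop s V C)   = cop s (renV ρ V) (renC (ext ρ) C)

  Sub : List Ty → List Ty → Set
  Sub Γ Δ = ∀ {T} → Γ ∋ T → Val Δ T

  exts : ∀ {Γ Δ U} → Sub Γ Δ → Sub (U ∷ Γ) (U ∷ Δ)
  exts σ here      = vvar here
  exts σ (there x) = renV there (σ x)

  subV : ∀ {Γ Δ T} → Sub Γ Δ → Val Γ T → Val Δ T
  subC : ∀ {Γ Δ T} → Sub Γ Δ → Comp Γ T → Comp Δ T
  subV σ (vvar x)   = σ x
  subV σ (vcon b v) = vcon b v
  subV σ (num i)    = num i
  subV σ (vlam C)   = vlam (subC (exts σ) C)
  subV σ (vfix V)   = vfix (subV (exts σ) V)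
  subC σ (capp V W)   = capp (subV σ V) (subV σ W)
  subC σ (cret V)     = cret (subV σ V)
  subC σ (clet C B)   = clet (subC σ C) (subC (exts σ) B)
  subC σ (ccase V Cs) = ccase (subV σ V) (λ i → subC σ (Cs i))
  subC σ (cop s V C)  = cop s (subV σ V) (subC (exts σ) C)

  σ₀ : ∀ {Γ U} → Val Γ U → Sub (U ∷ Γ) Γ
  σ₀ W here      = W
  σ₀ W (there x) = vvar x

  _[_]ᵥ : ∀ {Γ T U} → Val (U ∷ Γ) T → Val Γ U → Val Γ T
  V [ W ]ᵥ = subV (σ₀ W) V

  _[_]c : ∀ {Γ T U} → Comp (U ∷ Γ) T → Val Γ U → Comp Γ T
  C [ W ]c = subC (σ₀ W) C

  infix 4 _⟶_ _⟶*_
  data _⟶_ {Γ} : ∀ {T} → Comp Γ T → Comp Γ T → Set where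
    β-lam  : ∀ {T U} {C : Comp (T ∷ Γ) U} {W} → capp (vlam C) W ⟶ C [ W ]c
    β-fix  : ∀ {T U} {V : Val ((T ⇛ U) ∷ Γ) (T ⇛ U)} {W} →
             capp (vfix V) W ⟶ capp (V [ vfix V ]ᵥ) W
    β-case : ∀ {k T} {i : Fin k} {Cs : Fin k → Comp Γ T} → ccase (num i) Cs ⟶ Cs i
    β-let  : ∀ {T U} {V : Val Γ T} {B : Comp (T ∷ Γ) U} → clet (cret V) B ⟶ B [ V ]c
    op-let : ∀ {T U s} {V : Val Γ (gty (par s))} {C : Comp (enm (ar s) ∷ Γ) T}
               {B : Comp (T ∷ Γ) U} →
             clet (cop s V C) B ⟶ cop s V (clet C (renC (ext there) B))
    ξ-let  : ∀ {T U} {C C' : Comp Γ T} {B : Comp (T ∷ Γ) U} →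
             C ⟶ C' → clet C B ⟶ clet C' B

  _⟶*_ : ∀ {Γ T} → Comp Γ T → Comp Γ T → Set
  _⟶*_ = Star _⟶_

  data Terminal {T} : Comp [] T → Set where
    t-ret : (V : Val [] T) → Terminal (cret V)
    t-op  : ∀ s V (C : Comp (enm (ar s) ∷ []) T) → Terminal (cop s V C)

  Diverges : ∀ {T} → Comp [] T → Set
  Diverges C = ∀ C' → C ⟶* C' → ¬ Terminal C'

  -- ETAt C p ℓ  ⇔  the label of ET(C) at position p is ℓ, where
  -- ET(C) = ⊥ | return(V) | σ(v, ET(C'[x:=0̲]), …, ET(C'[x:=k-1̲]))
  -- (the parameter v is child 0, ET(C'[x:=i̲]) is child i+1)
  data ETAt {T} (C : Comp [] T) : Path → Label (Val [] T) → Set where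
    et-bot    : Diverges C → ETAt C [] ⊥ℓ
    et-bot↓   : ∀ {i p} → Diverges C → ETAt C (i ∷ p) none
    et-ret    : ∀ {V} → C ⟶* cret V → ETAt C [] (retℓ V)
    et-ret↓   : ∀ {V i p} → C ⟶* cret V → ETAt C (i ∷ p) none
    et-op     : ∀ {s v C'} → C ⟶* cop s (vcon (par s) v) C' → ETAt C [] (symℓ (symσ s))
    et-param  : ∀ {s v C'} → C ⟶* cop s (vcon (par s) v) C' →
                ETAt C (0 ∷ []) (symℓ (symv (par s) v))
    et-param↓ : ∀ {s v C' j p} → C ⟶* cop s (vcon (par s) v) C' →
                ETAt C (0 ∷ j ∷ p) none
    et-child  : ∀ {s v C' p ℓ} → C ⟶* cop s (vcon (par s) v) C' →
                (i : Fin (ar s)) → ETAt (C' [ num i ]c) p ℓ → ETAt C (suc (toℕ i) ∷ p) ℓ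
    et-out    : ∀ {s v C' j p} → C ⟶* cop s (vcon (par s) v) C' →
                arity (symσ s) ≤ j → ETAt C (j ∷ p) none

  IsET : ∀ {T} → Comp [] T → Tree (Val [] T) → Set
  IsET C t = ∀ p → ETAt C p (t p)

  ⟦_⟧ : Ty → LTy
  ⟦ gty b ⟧ = o
  ⟦ enm k ⟧ = os k
  ⟦ T ⇛ U ⟧ = ⟦ T ⟧ ⇒ neg ⟦ U ⟧ ⇒ o

  ⟦_⟧ctx : List Ty → List LTy
  ⟦ Γ ⟧ctx = map ⟦_⟧ Γ

  ⟦_⟧var : ∀ {Γ T} → Γ ∋ T → ⟦ Γ ⟧ctx ∋ ⟦ T ⟧
  ⟦ here ⟧var    = here
  ⟦ there x ⟧var = there ⟦ x ⟧var

  constk : ∀ {Γ} k → Tm Γ o → Tm Γ (os k)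
  constk zero    M = M
  constk (suc k) M = lam (constk k (lwk M))

  projk : ∀ {Γ} k → Fin k → Tm Γ (os k)
  projk (suc k) zero    = lam (constk k (var here))
  projk (suc k) (suc i) = lam (lwk (projk k i))

  ⟦_⟧v : ∀ {Γ T} → Val Γ T → Tm ⟦ Γ ⟧ctx ⟦ T ⟧
  ⟦_⟧c : ∀ {Γ T} → Comp Γ T → Tm ⟦ Γ ⟧ctx (neg ⟦ T ⟧ ⇒ o)
  ⟦ vvar x ⟧v          = var ⟦ x ⟧var
  ⟦ vcon b v ⟧v        = con b v
  ⟦ num {k} i ⟧v       = projk k i
  ⟦ vlam C ⟧v          = lam ⟦ C ⟧c
  ⟦ vfix V ⟧v          = app Y (lam ⟦ V ⟧v)
  ⟦ capp V W ⟧c        = lam (app (app (lwk ⟦ V ⟧v) (lwk ⟦ W ⟧v)) (var here))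
  ⟦ cret V ⟧c          = lam (app (var here) (lwk ⟦ V ⟧v))
  ⟦ ccase V Cs ⟧c      = lam (apps (lwk ⟦ V ⟧v) (λ i → app (lwk ⟦ Cs i ⟧c) (var here)))
  ⟦ clet C B ⟧c        = lam (app (lwk ⟦ C ⟧c) (lam (app (lwk₁ ⟦ B ⟧c) (var (there here)))))
  ⟦ cop s V C ⟧c       = lam (apps (app (opc s) (lwk ⟦ V ⟧v))
                                   (λ i → app (lwk (⟦ C ⟧c [ projk (ar s) i ]ₗ)) (var here)))

-- Each EPCF step C ⟶ C' is mirrored by the CPS images: for every continuation k,
-- C* k and C'* k have a common weak head reduct, reached in strictly fewer steps from
-- C'* k, except after the let/operation commutation, where both sides reach the same
-- operation head with children of equal Böhm trees. Hence C* k has the Böhm tree of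
-- D* k for every reduct D of C. A terminal D = return(V) gives D* k ↦ k V*, and
-- D = σ(v; x.C') gives D* k ↦ σ v (C'[x:=0̲]* k) ⋯, whose children are handled by
-- induction on the position. If C diverges, each of its steps strictly shortens any weak
-- head reduction of C* k to a head normal form, so there is none and BT(C* k) = ⊥.

module Submission where

open import Defs
open import Data.Empty using (⊥; ⊥-elim)
open import Data.Fin using (Fin; zero; suc; toℕ)
open import Data.Fin.Properties using (toℕ<n; toℕ-injective)
open import Data.List using ([]; _∷_)
open import Data.Maybe using (Maybe; just; nothing)
open import Data.Nat using (ℕ; zero; suc; pred; _+_; _≤_; _<_; z≤n; s≤s)
open import Data.Nat.Induction using (<-wellFounded)
open import Data.Nat.Properties using (+-monoˡ-<; <⇒≱)
open import Data.Sum using (_⊎_; inj₁; inj₂)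
open import Data.Product using (Σ; ∃; _,_; proj₁; proj₂; _×_)
open import Induction.WellFounded using (Acc; acc)
open import Relation.Nullary using (¬_)
open import Relation.Binary.PropositionalEquality
open import Relation.Binary.Construct.Closure.ReflexiveTransitive using (Star; ε; _◅_; _◅◅_)

steps : ∀ {A : Set} {R : A → A → Set} {x y} → Star R x y → ℕ
steps ε       = 0
steps (_ ◅ r) = suc (steps r)

steps-◅◅ : ∀ {A : Set} {R : A → A → Set} {x y z} (r : Star R x y) (r' : Star R y z) →
           steps (r ◅◅ r') ≡ steps r + steps r'
steps-◅◅ ε       r' = refl
steps-◅◅ (_ ◅ r) r' = cong suc (steps-◅◅ r r')

data InRange (n : ℕ) : ℕ → Set where
  inside  : (j : Fin n) → InRange n (toℕ j)
  outside : ∀ {i} → n ≤ i → InRange n i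

inRange : ∀ n i → InRange n i
inRange zero    i       = outside z≤n
inRange (suc n) zero    = inside zero
inRange (suc n) (suc i) with inRange n i
... | inside j    = inside (suc j)
... | outside n≤i = outside (s≤s n≤i)

module Deterministic {A : Set} (R : A → A → Set)
                     (deterministic : ∀ {x y z} → R x y → R x z → y ≡ z) where

  Normal : A → Set
  Normal x = ∀ {y} → ¬ R x y

  remainder : ∀ {x y z} (r : Star R x y) (r₁ : Star R x z) → Normal y →
              Σ (Star R z y) λ r₂ → steps r₁ + steps r₂ ≡ steps r
  remainder r        ε         _ = r , refl
  remainder ε        (s₁ ◅ r₁) n = ⊥-elim (n s₁)
  remainder (s ◅ r)  (s₁ ◅ r₁) n with deterministic s s₁
  ... | refl with remainder r r₁ n
  ...   | r₂ , eq = r₂ , cong suc eq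

  normal-unique : ∀ {x y z} → Star R x y → Star R x z → Normal y → Normal z → y ≡ z
  normal-unique r r₁ ny nz with remainder r r₁ ny
  ... | ε     , _ = refl
  ... | s ◅ _ , _ = ⊥-elim (nz s)

module CPSCorrectness (S : Sig) where
  open Theory S

  -- Renaming and substitution in the λY-calculus

  infix 4 _≗ᵛ_
  _≗ᵛ_ : ∀ {Γ} {F : LTy → Set} (f g : ∀ {A} → Γ ∋ A → F A) → Set
  _≗ᵛ_ {Γ} f g = ∀ {A} (x : Γ ∋ A) → f x ≡ g x

  lext-cong : ∀ {Γ Δ B} {ρ ρ' : LRen Γ Δ} → ρ ≗ᵛ ρ' → lext {B = B} ρ ≗ᵛ lext ρ'
  lext-cong h here      = refl
  lext-cong h (there x) = cong there (h x)

  lren-cong : ∀ {Γ Δ A} {ρ ρ' : LRen Γ Δ} → ρ ≗ᵛ ρ' → (M : Tm Γ A) → lren ρ M ≡ lren ρ' M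
  lren-cong h (var x)   = cong var (h x)
  lren-cong h (lam M)   = cong lam (lren-cong (lext-cong h) M)
  lren-cong h (app M N) = cong₂ app (lren-cong h M) (lren-cong h N)
  lren-cong h Y         = refl
  lren-cong h (con b v) = refl
  lren-cong h (opc s)   = refl

  lexts-cong : ∀ {Γ Δ B} {σ σ' : LSub Γ Δ} → σ ≗ᵛ σ' → lexts {B = B} σ ≗ᵛ lexts σ'
  lexts-cong h here      = refl
  lexts-cong h (there x) = cong lwk (h x)

  lsub-cong : ∀ {Γ Δ A} {σ σ' : LSub Γ Δ} → σ ≗ᵛ σ' → (M : Tm Γ A) → lsub σ M ≡ lsub σ' M
  lsub-cong h (var x)   = h x
  lsub-cong h (lam M)   = cong lam (lsub-cong (lexts-cong h) M)
  lsub-cong h (app M N) = cong₂ app (lsub-cong h M) (lsub-cong h N)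
  lsub-cong h Y         = refl
  lsub-cong h (con b v) = refl
  lsub-cong h (opc s)   = refl

  lren-lren : ∀ {Γ Δ Θ A} (ρ₁ : LRen Γ Δ) (ρ₂ : LRen Δ Θ) (M : Tm Γ A) →
              lren ρ₂ (lren ρ₁ M) ≡ lren (λ x → ρ₂ (ρ₁ x)) M
  lren-lren ρ₁ ρ₂ (var x)   = refl
  lren-lren ρ₁ ρ₂ (lam M)   = cong lam (trans (lren-lren (lext ρ₁) (lext ρ₂) M)
                                (lren-cong (λ { here → refl ; (there x) → refl }) M))
  lren-lren ρ₁ ρ₂ (app M N) = cong₂ app (lren-lren ρ₁ ρ₂ M) (lren-lren ρ₁ ρ₂ N)
  lren-lren ρ₁ ρ₂ Y         = refl
  lren-lren ρ₁ ρ₂ (con b v) = refl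
  lren-lren ρ₁ ρ₂ (opc s)   = refl

  lsub-lren : ∀ {Γ Δ Θ A} (ρ : LRen Γ Δ) (σ : LSub Δ Θ) (M : Tm Γ A) →
              lsub σ (lren ρ M) ≡ lsub (λ x → σ (ρ x)) M
  lsub-lren ρ σ (var x)   = refl
  lsub-lren ρ σ (lam M)   = cong lam (trans (lsub-lren (lext ρ) (lexts σ) M)
                              (lsub-cong (λ { here → refl ; (there x) → refl }) M))
  lsub-lren ρ σ (app M N) = cong₂ app (lsub-lren ρ σ M) (lsub-lren ρ σ N)
  lsub-lren ρ σ Y         = refl
  lsub-lren ρ σ (con b v) = refl
  lsub-lren ρ σ (opc s)   = refl

  lext-lwk : ∀ {Γ Δ A B} (ρ : LRen Γ Δ) (M : Tm Γ A) → lren (lext {B = B} ρ) (lwk M) ≡ lwk (lren ρ M)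
  lext-lwk ρ M = trans (lren-lren there (lext ρ) M) (sym (lren-lren ρ there M))

  lren-lsub : ∀ {Γ Δ Θ A} (σ : LSub Γ Δ) (ρ : LRen Δ Θ) (M : Tm Γ A) →
              lren ρ (lsub σ M) ≡ lsub (λ x → lren ρ (σ x)) M
  lren-lsub σ ρ (var x)   = refl
  lren-lsub σ ρ (lam M)   = cong lam (trans (lren-lsub (lexts σ) (lext ρ) M)
                              (lsub-cong (λ { here → refl ; (there x) → lext-lwk ρ (σ x) }) M))
  lren-lsub σ ρ (app M N) = cong₂ app (lren-lsub σ ρ M) (lren-lsub σ ρ N)
  lren-lsub σ ρ Y         = refl
  lren-lsub σ ρ (con b v) = refl
  lren-lsub σ ρ (opc s)   = refl

  lexts-lwk : ∀ {Γ Δ A B} (σ : LSub Γ Δ) (M : Tm Γ A) → lsub (lexts {B = B} σ) (lwk M) ≡ lwk (lsub σ M)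
  lexts-lwk σ M = trans (lsub-lren there (lexts σ) M) (sym (lren-lsub σ there M))

  lsub-lsub : ∀ {Γ Δ Θ A} (σ₁ : LSub Γ Δ) (σ₂ : LSub Δ Θ) (M : Tm Γ A) →
              lsub σ₂ (lsub σ₁ M) ≡ lsub (λ x → lsub σ₂ (σ₁ x)) M
  lsub-lsub σ₁ σ₂ (var x)   = refl
  lsub-lsub σ₁ σ₂ (lam M)   = cong lam (trans (lsub-lsub (lexts σ₁) (lexts σ₂) M)
                                (lsub-cong (λ { here → refl ; (there x) → lexts-lwk σ₂ (σ₁ x) }) M))
  lsub-lsub σ₁ σ₂ (app M N) = cong₂ app (lsub-lsub σ₁ σ₂ M) (lsub-lsub σ₁ σ₂ N)
  lsub-lsub σ₁ σ₂ Y         = refl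
  lsub-lsub σ₁ σ₂ (con b v) = refl
  lsub-lsub σ₁ σ₂ (opc s)   = refl

  lsub-var : ∀ {Γ A} (M : Tm Γ A) → lsub var M ≡ M
  lsub-var (var x)   = refl
  lsub-var (lam M)   = cong lam (trans (lsub-cong (λ { here → refl ; (there x) → refl }) M) (lsub-var M))
  lsub-var (app M N) = cong₂ app (lsub-var M) (lsub-var N)
  lsub-var Y         = refl
  lsub-var (con b v) = refl
  lsub-var (opc s)   = refl

  lwk-[]ₗ : ∀ {Γ A B} (M : Tm Γ A) (N : Tm Γ B) → lwk M [ N ]ₗ ≡ M
  lwk-[]ₗ M N = trans (lsub-lren there (lσ₀ N) M) (lsub-var M)

  lwk₁-lexts-lσ₀ : ∀ {Γ A B C} (M : Tm (C ∷ Γ) A) (N : Tm Γ B) → lsub (lexts (lσ₀ N)) (lwk₁ M) ≡ M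
  lwk₁-lexts-lσ₀ M N = trans (lsub-lren (lext there) (lexts (lσ₀ N)) M)
    (trans (lsub-cong (λ { here → refl ; (there x) → refl }) M) (lsub-var M))

  lwk₁-lren : ∀ {Γ Δ A B C} (ρ : LRen Γ Δ) (M : Tm (C ∷ Γ) A) →
              lwk₁ {B = B} (lren (lext ρ) M) ≡ lren (lext (lext ρ)) (lwk₁ M)
  lwk₁-lren ρ M = trans (lren-lren (lext ρ) (lext there) M)
    (trans (lren-cong (λ { here → refl ; (there x) → refl }) M) (sym (lren-lren (lext there) (lext (lext ρ)) M)))

  lwk₁-lsub : ∀ {Γ Δ A B C} (σ : LSub Γ Δ) (M : Tm (C ∷ Γ) A) →
              lwk₁ {B = B} (lsub (lexts σ) M) ≡ lsub (lexts (lexts σ)) (lwk₁ M)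
  lwk₁-lsub σ M = trans (lren-lsub (lexts σ) (lext there) M)
    (trans (lsub-cong (λ { here → refl ; (there x) → lext-lwk there (σ x) }) M)
      (sym (lsub-lren (lext there) (lexts (lexts σ)) M)))

  lren-[]ₗ : ∀ {Γ Δ A B} (ρ : LRen Γ Δ) (M : Tm (B ∷ Γ) A) (N : Tm Γ B) →
             lren (lext ρ) M [ lren ρ N ]ₗ ≡ lren ρ (M [ N ]ₗ)
  lren-[]ₗ ρ M N = trans (lsub-lren (lext ρ) (lσ₀ (lren ρ N)) M)
    (trans (lsub-cong (λ { here → refl ; (there x) → refl }) M) (sym (lren-lsub (lσ₀ N) ρ M)))

  lsub-[]ₗ : ∀ {Γ Δ A B} (σ : LSub Γ Δ) (M : Tm (B ∷ Γ) A) (N : Tm Γ B) →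
             lsub (lexts σ) M [ lsub σ N ]ₗ ≡ lsub σ (M [ N ]ₗ)
  lsub-[]ₗ σ M N = trans (lsub-lsub (lexts σ) (lσ₀ (lsub σ N)) M)
    (trans (lsub-cong (λ { here → refl ; (there x) → lwk-[]ₗ (σ x) (lsub σ N) }) M)
      (sym (lsub-lsub (lσ₀ N) σ M)))

  apps-cong : ∀ {Γ n} {h h' : Tm Γ (os n)} {Ms Ns : Fin n → Tm Γ o} →
              h ≡ h' → (∀ i → Ms i ≡ Ns i) → apps h Ms ≡ apps h' Ns
  apps-cong {n = zero}  eh e = eh
  apps-cong {n = suc n} eh e = apps-cong (cong₂ app eh (e zero)) (λ i → e (suc i))

  lren-apps : ∀ {Γ Δ n} (ρ : LRen Γ Δ) (h : Tm Γ (os n)) (Ms : Fin n → Tm Γ o) →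
              lren ρ (apps h Ms) ≡ apps (lren ρ h) (λ i → lren ρ (Ms i))
  lren-apps {n = zero}  ρ h Ms = refl
  lren-apps {n = suc n} ρ h Ms = lren-apps ρ (app h (Ms zero)) (λ i → Ms (suc i))

  lsub-apps : ∀ {Γ Δ n} (σ : LSub Γ Δ) (h : Tm Γ (os n)) (Ms : Fin n → Tm Γ o) →
              lsub σ (apps h Ms) ≡ apps (lsub σ h) (λ i → lsub σ (Ms i))
  lsub-apps {n = zero}  σ h Ms = refl
  lsub-apps {n = suc n} σ h Ms = lsub-apps σ (app h (Ms zero)) (λ i → Ms (suc i))

  lren-constk : ∀ {Γ Δ} k (ρ : LRen Γ Δ) (M : Tm Γ o) → lren ρ (constk k M) ≡ constk k (lren ρ M)
  lren-constk zero    ρ M = refl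
  lren-constk (suc k) ρ M = cong lam (trans (lren-constk k (lext ρ) (lwk M)) (cong (constk k) (lext-lwk ρ M)))

  lsub-constk : ∀ {Γ Δ} k (σ : LSub Γ Δ) (M : Tm Γ o) → lsub σ (constk k M) ≡ constk k (lsub σ M)
  lsub-constk zero    σ M = refl
  lsub-constk (suc k) σ M = cong lam (trans (lsub-constk k (lexts σ) (lwk M)) (cong (constk k) (lexts-lwk σ M)))

  lren-projk : ∀ {Γ Δ} k (i : Fin k) (ρ : LRen Γ Δ) → lren ρ (projk k i) ≡ projk k i
  lren-projk (suc k) zero    ρ = cong lam (lren-constk k (lext ρ) (var here))
  lren-projk (suc k) (suc i) ρ = cong lam (trans (lext-lwk ρ (projk k i)) (cong lwk (lren-projk k i ρ)))

  lsub-projk : ∀ {Γ Δ} k (i : Fin k) (σ : LSub Γ Δ) → lsub σ (projk k i) ≡ projk k i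
  lsub-projk (suc k) zero    σ = cong lam (lsub-constk k (lexts σ) (var here))
  lsub-projk (suc k) (suc i) σ = cong lam (trans (lexts-lwk σ (projk k i)) (cong lwk (lsub-projk k i σ)))

  -- The CPS translation commutes with substitution

  cong-lwk-lren : ∀ {Γ Δ A B} (ρ : LRen Γ Δ) (N : Tm Γ A) {M : Tm Δ A} →
                  M ≡ lren ρ N → lwk {B = B} M ≡ lren (lext ρ) (lwk N)
  cong-lwk-lren ρ N eq = trans (cong lwk eq) (sym (lext-lwk ρ N))

  cong-lwk-lsub : ∀ {Γ Δ A B} (σ : LSub Γ Δ) (N : Tm Γ A) {M : Tm Δ A} →
                  M ≡ lsub σ N → lwk {B = B} M ≡ lsub (lexts σ) (lwk N)
  cong-lwk-lsub σ N eq = trans (cong lwk eq) (sym (lexts-lwk σ N))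

  RenCPS : ∀ {Γ Δ} → Ren Γ Δ → LRen ⟦ Γ ⟧ctx ⟦ Δ ⟧ctx → Set
  RenCPS {Γ} ρ ρ' = ∀ {T} (x : Γ ∋ T) → ρ' ⟦ x ⟧var ≡ ⟦ ρ x ⟧var

  ext-RenCPS : ∀ {Γ Δ U} {ρ : Ren Γ Δ} {ρ' : LRen ⟦ Γ ⟧ctx ⟦ Δ ⟧ctx} →
               RenCPS ρ ρ' → RenCPS (ext {U = U} ρ) (lext ρ')
  ext-RenCPS h here      = refl
  ext-RenCPS h (there x) = cong there (h x)

  ⟦renV⟧ : ∀ {Γ Δ T} {ρ : Ren Γ Δ} (ρ' : LRen ⟦ Γ ⟧ctx ⟦ Δ ⟧ctx) → RenCPS ρ ρ' →
           (V : Val Γ T) → ⟦ renV ρ V ⟧v ≡ lren ρ' ⟦ V ⟧v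
  ⟦renC⟧ : ∀ {Γ Δ T} {ρ : Ren Γ Δ} (ρ' : LRen ⟦ Γ ⟧ctx ⟦ Δ ⟧ctx) → RenCPS ρ ρ' →
           (C : Comp Γ T) → ⟦ renC ρ C ⟧c ≡ lren ρ' ⟦ C ⟧c
  ⟦renV⟧ ρ' h (vvar x)    = cong var (sym (h x))
  ⟦renV⟧ ρ' h (vcon b v)  = refl
  ⟦renV⟧ ρ' h (num {k} i) = sym (lren-projk k i ρ')
  ⟦renV⟧ ρ' h (vlam C)    = cong lam (⟦renC⟧ (lext ρ') (ext-RenCPS h) C)
  ⟦renV⟧ ρ' h (vfix V)    = cong (λ M → app Y (lam M)) (⟦renV⟧ (lext ρ') (ext-RenCPS h) V)
  ⟦renC⟧ ρ' h (capp V W)  = cong (λ M → lam (app M (var here))) (cong₂ app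
    (cong-lwk-lren ρ' ⟦ V ⟧v (⟦renV⟧ ρ' h V))
    (cong-lwk-lren ρ' ⟦ W ⟧v (⟦renV⟧ ρ' h W)))
  ⟦renC⟧ ρ' h (cret V)    = cong (λ M → lam (app (var here) M))
    (cong-lwk-lren ρ' ⟦ V ⟧v (⟦renV⟧ ρ' h V))
  ⟦renC⟧ ρ' h (clet C B)  = cong lam (cong₂ app
    (cong-lwk-lren ρ' ⟦ C ⟧c (⟦renC⟧ ρ' h C))
    (cong (λ M → lam (app M (var (there here))))
      (trans (cong lwk₁ (⟦renC⟧ (lext ρ') (ext-RenCPS h) B)) (lwk₁-lren ρ' ⟦ B ⟧c))))
  ⟦renC⟧ ρ' h (ccase V Cs) = cong lam (trans
    (apps-cong (cong-lwk-lren ρ' ⟦ V ⟧v (⟦renV⟧ ρ' h V))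
      (λ i → cong (λ M → app M (var here)) (cong-lwk-lren ρ' ⟦ Cs i ⟧c (⟦renC⟧ ρ' h (Cs i)))))
    (sym (lren-apps (lext ρ') (lwk ⟦ V ⟧v) _)))
  ⟦renC⟧ ρ' h (cop s V C) = cong lam (trans
    (apps-cong (cong (app (opc s)) (cong-lwk-lren ρ' ⟦ V ⟧v (⟦renV⟧ ρ' h V)))
      (λ i → cong (λ M → app M (var here)) (cong-lwk-lren ρ' (⟦ C ⟧c [ projk (ar s) i ]ₗ) (body i))))
    (sym (lren-apps (lext ρ') (app (opc s) (lwk ⟦ V ⟧v)) _)))
    where
    body : ∀ i → ⟦ renC (ext _) C ⟧c [ projk (ar s) i ]ₗ ≡ lren ρ' (⟦ C ⟧c [ projk (ar s) i ]ₗ)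
    body i = trans (cong₂ _[_]ₗ (⟦renC⟧ (lext ρ') (ext-RenCPS h) C) (sym (lren-projk (ar s) i ρ')))
                   (lren-[]ₗ ρ' ⟦ C ⟧c (projk (ar s) i))

  SubCPS : ∀ {Γ Δ} → Sub Γ Δ → LSub ⟦ Γ ⟧ctx ⟦ Δ ⟧ctx → Set
  SubCPS {Γ} σ σ' = ∀ {T} (x : Γ ∋ T) → σ' ⟦ x ⟧var ≡ ⟦ σ x ⟧v

  exts-SubCPS : ∀ {Γ Δ U} {σ : Sub Γ Δ} {σ' : LSub ⟦ Γ ⟧ctx ⟦ Δ ⟧ctx} →
                SubCPS σ σ' → SubCPS (exts {U = U} σ) (lexts σ')
  exts-SubCPS h here = refl
  exts-SubCPS {σ = σ} h (there x) = trans (cong lwk (h x)) (sym (⟦renV⟧ there (λ _ → refl) (σ x)))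

  σ₀-SubCPS : ∀ {Γ U} (W : Val Γ U) → SubCPS (σ₀ W) (lσ₀ ⟦ W ⟧v)
  σ₀-SubCPS W here      = refl
  σ₀-SubCPS W (there x) = refl

  ⟦subV⟧ : ∀ {Γ Δ T} {σ : Sub Γ Δ} (σ' : LSub ⟦ Γ ⟧ctx ⟦ Δ ⟧ctx) → SubCPS σ σ' →
           (V : Val Γ T) → ⟦ subV σ V ⟧v ≡ lsub σ' ⟦ V ⟧v
  ⟦subC⟧ : ∀ {Γ Δ T} {σ : Sub Γ Δ} (σ' : LSub ⟦ Γ ⟧ctx ⟦ Δ ⟧ctx) → SubCPS σ σ' →
           (C : Comp Γ T) → ⟦ subC σ C ⟧c ≡ lsub σ' ⟦ C ⟧c
  ⟦subV⟧ σ' h (vvar x)    = sym (h x)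
  ⟦subV⟧ σ' h (vcon b v)  = refl
  ⟦subV⟧ σ' h (num {k} i) = sym (lsub-projk k i σ')
  ⟦subV⟧ σ' h (vlam C)    = cong lam (⟦subC⟧ (lexts σ') (exts-SubCPS h) C)
  ⟦subV⟧ σ' h (vfix V)    = cong (λ M → app Y (lam M)) (⟦subV⟧ (lexts σ') (exts-SubCPS h) V)
  ⟦subC⟧ σ' h (capp V W)  = cong (λ M → lam (app M (var here))) (cong₂ app
    (cong-lwk-lsub σ' ⟦ V ⟧v (⟦subV⟧ σ' h V))
    (cong-lwk-lsub σ' ⟦ W ⟧v (⟦subV⟧ σ' h W)))
  ⟦subC⟧ σ' h (cret V)    = cong (λ M → lam (app (var here) M))
    (cong-lwk-lsub σ' ⟦ V ⟧v (⟦subV⟧ σ' h V))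
  ⟦subC⟧ σ' h (clet C B)  = cong lam (cong₂ app
    (cong-lwk-lsub σ' ⟦ C ⟧c (⟦subC⟧ σ' h C))
    (cong (λ M → lam (app M (var (there here))))
      (trans (cong lwk₁ (⟦subC⟧ (lexts σ') (exts-SubCPS h) B)) (lwk₁-lsub σ' ⟦ B ⟧c))))
  ⟦subC⟧ σ' h (ccase V Cs) = cong lam (trans
    (apps-cong (cong-lwk-lsub σ' ⟦ V ⟧v (⟦subV⟧ σ' h V))
      (λ i → cong (λ M → app M (var here)) (cong-lwk-lsub σ' ⟦ Cs i ⟧c (⟦subC⟧ σ' h (Cs i)))))
    (sym (lsub-apps (lexts σ') (lwk ⟦ V ⟧v) _)))
  ⟦subC⟧ σ' h (cop s V C) = cong lam (trans
    (apps-cong (cong (app (opc s)) (cong-lwk-lsub σ' ⟦ V ⟧v (⟦subV⟧ σ' h V)))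
      (λ i → cong (λ M → app M (var here)) (cong-lwk-lsub σ' (⟦ C ⟧c [ projk (ar s) i ]ₗ) (body i))))
    (sym (lsub-apps (lexts σ') (app (opc s) (lwk ⟦ V ⟧v)) _)))
    where
    body : ∀ i → ⟦ subC (exts _) C ⟧c [ projk (ar s) i ]ₗ ≡ lsub σ' (⟦ C ⟧c [ projk (ar s) i ]ₗ)
    body i = trans (cong₂ _[_]ₗ (⟦subC⟧ (lexts σ') (exts-SubCPS h) C) (sym (lsub-projk (ar s) i σ')))
                   (lsub-[]ₗ σ' ⟦ C ⟧c (projk (ar s) i))

  ⟦[]c⟧ : ∀ {Γ T U} (C : Comp (U ∷ Γ) T) (W : Val Γ U) → ⟦ C [ W ]c ⟧c ≡ ⟦ C ⟧c [ ⟦ W ⟧v ]ₗ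
  ⟦[]c⟧ C W = ⟦subC⟧ (lσ₀ ⟦ W ⟧v) (σ₀-SubCPS W) C

  ⟦[]ᵥ⟧ : ∀ {Γ T U} (V : Val (U ∷ Γ) T) (W : Val Γ U) → ⟦ V [ W ]ᵥ ⟧v ≡ ⟦ V ⟧v [ ⟦ W ⟧v ]ₗ
  ⟦[]ᵥ⟧ V W = ⟦subV⟧ (lσ₀ ⟦ W ⟧v) (σ₀-SubCPS W) V

  -- Determinism and Böhm trees

  ↦-deterministic : ∀ {Γ A} {M N N' : Tm Γ A} → M ↦ N → M ↦ N' → N ≡ N'
  ↦-deterministic β      β       = refl
  ↦-deterministic β      (ξ ())
  ↦-deterministic δY     δY      = refl
  ↦-deterministic δY     (ξ ())
  ↦-deterministic (ξ ()) β
  ↦-deterministic (ξ ()) δY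
  ↦-deterministic (ξ s)  (ξ s')  = cong (λ M → app M _) (↦-deterministic s s')

  ⟶-deterministic : ∀ {Γ T} {C D D' : Comp Γ T} → C ⟶ D → C ⟶ D' → D ≡ D'
  ⟶-deterministic β-lam      β-lam       = refl
  ⟶-deterministic β-fix      β-fix       = refl
  ⟶-deterministic β-case     β-case      = refl
  ⟶-deterministic β-let      β-let       = refl
  ⟶-deterministic β-let      (ξ-let ())
  ⟶-deterministic op-let     op-let      = refl
  ⟶-deterministic op-let     (ξ-let ())
  ⟶-deterministic (ξ-let ()) β-let
  ⟶-deterministic (ξ-let ()) op-let
  ⟶-deterministic (ξ-let s)  (ξ-let s')  = cong (λ C → clet C _) (⟶-deterministic s s')

  module WH = Deterministic (_↦_ {[]} {o}) ↦-deterministic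
  module Eval {T} = Deterministic (_⟶_ {[]} {T}) ⟶-deterministic

  terminal-normal : ∀ {T} {C : Comp [] T} → Terminal C → Eval.Normal C
  terminal-normal (t-ret V)    ()
  terminal-normal (t-op s V C) ()

  terminal-unique : ∀ {T} {C D D' : Comp [] T} → C ⟶* D → C ⟶* D' →
                    Terminal D → Terminal D' → D ≡ D'
  terminal-unique r r' t t' = Eval.normal-unique r r' (terminal-normal t) (terminal-normal t')

  head : ∀ {Γ A} → Tm Γ A → Maybe Sym
  head (app M N) = head M
  head (con b v) = just (symv b v)
  head (opc s)   = just (symσ s)
  head _         = nothing

  head-apps : ∀ {Γ n} (h : Tm Γ (os n)) Ms → head (apps h Ms) ≡ head h
  head-apps {n = zero}  h Ms = refl
  head-apps {n = suc n} h Ms = head-apps (app h (Ms zero)) (λ i → Ms (suc i))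

  head-symTm : ∀ {Γ} f → head {Γ} (symTm f) ≡ just f
  head-symTm (symv b v) = refl
  head-symTm (symσ s)   = refl

  head-apps-symTm : ∀ {Γ} f (Ms : Fin (arity f) → Tm Γ o) → head (apps (symTm f) Ms) ≡ just f
  head-apps-symTm f Ms = trans (head-apps (symTm f) Ms) (head-symTm f)

  head-just-normal : ∀ {Γ A} {M N : Tm Γ A} {f} → head M ≡ just f → ¬ M ↦ N
  head-just-normal () β
  head-just-normal () δY
  head-just-normal h  (ξ s) = head-just-normal h s

  hnf-normal : ∀ {M} → HNF M → WH.Normal M
  hnf-normal (hnf f Ms) = head-just-normal (head-apps-symTm f Ms)

  apps-symTm-normal : ∀ f (Ms : Fin (arity f) → Tm [] o) → WH.Normal (apps (symTm f) Ms)
  apps-symTm-normal f Ms = hnf-normal (hnf f Ms)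

  app-injective : ∀ {Γ A B} {M M' : Tm Γ (A ⇒ B)} {N N'} → app M N ≡ app M' N' → M ≡ M' × N ≡ N'
  app-injective refl = refl , refl

  apps-injective : ∀ {Γ n} {h h' : Tm Γ (os n)} {Ms Ns} →
                   apps h Ms ≡ apps h' Ns → h ≡ h' × (∀ i → Ms i ≡ Ns i)
  apps-injective {n = zero}  eq = eq , λ ()
  apps-injective {n = suc n} eq with apps-injective {n = n} eq
  ... | eq₀ , eqs with app-injective eq₀
  ...   | eqh , eqM = eqh , λ { zero → eqM ; (suc i) → eqs i }

  symTm-injective : ∀ f g (Ms : Fin (arity f) → Tm [] o) Ns → apps (symTm f) Ms ≡ apps (symTm g) Ns → f ≡ g
  symTm-injective f g Ms Ns eq
    with trans (sym (head-apps-symTm f Ms)) (trans (cong head eq) (head-apps-symTm g Ns))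
  ... | refl = refl

  InheritsBT : Tm [] o → Tm [] o → Set
  InheritsBT M N = ∀ {p ℓ} → BTAt N p ℓ → BTAt M p ℓ

  inheritsBT-trans : ∀ {M N P} → InheritsBT M N → InheritsBT N P → InheritsBT M P
  inheritsBT-trans m n h = m (n h)

  joinable-inheritsBT : ∀ {M N X} → M ↦* X → N ↦* X → InheritsBT M N
  joinable-inheritsBT {M} {N} {X} rM rN = inherit
    where
    via : ∀ {P Q H} → P ↦* X → Q ↦* X → Q ↦* H → WH.Normal H → P ↦* H
    via rP rQ rH nH = rP ◅◅ proj₁ (WH.remainder rH rQ nH)

    inherit : InheritsBT M N
    inherit (bt-bot nh)               = bt-bot (λ H r h → nh H (via rN rM r (hnf-normal h)) h)
    inherit (bt-bot↓ nh)              = bt-bot↓ (λ H r h → nh H (via rN rM r (hnf-normal h)) h)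
    inherit (bt-head {f} {Ms} r)      = bt-head (via rM rN r (apps-symTm-normal f Ms))
    inherit (bt-child {f} {Ms} r j h) = bt-child (via rM rN r (apps-symTm-normal f Ms)) j h
    inherit (bt-out {f} {Ms} r le)    = bt-out (via rM rN r (apps-symTm-normal f Ms)) le

  same-head-inheritsBT : ∀ {M N} f {Ms Ns} → M ↦* apps (symTm f) Ms → N ↦* apps (symTm f) Ns →
                         (∀ j → InheritsBT (Ms j) (Ns j)) → InheritsBT M N
  same-head-inheritsBT {M} {N} f {Ms} {Ns} rM rN children = inherit
    where
    reduct : ∀ g Ns' → N ↦* apps (symTm g) Ns' → apps (symTm f) Ns ≡ apps (symTm g) Ns'
    reduct g Ns' r = WH.normal-unique rN r (apps-symTm-normal f Ns) (apps-symTm-normal g Ns')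

    inherit : InheritsBT M N
    inherit (bt-bot nh)  = ⊥-elim (nh _ rN (hnf f Ns))
    inherit (bt-bot↓ nh) = ⊥-elim (nh _ rN (hnf f Ns))
    inherit (bt-head {g} {Ns'} r) with symTm-injective f g Ns Ns' (reduct g Ns' r)
    ... | refl = bt-head rM
    inherit (bt-child {g} {Ns'} r j h) with symTm-injective f g Ns Ns' (reduct g Ns' r)
    ... | refl = bt-child rM j
      (children j (subst (λ P → BTAt P _ _) (sym (proj₂ (apps-injective (reduct g Ns' r)) j)) h))
    inherit (bt-out {g} {Ns'} r le) with symTm-injective f g Ns Ns' (reduct g Ns' r)
    ... | refl = bt-out rM le

  infixl 6 _⟨≡⟩_
  _⟨≡⟩_ : ∀ {Γ A} {M N N' : Tm Γ A} → M ↦ N → N ≡ N' → M ↦ N'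
  s ⟨≡⟩ refl = s

  letCont : ∀ {T U} → Comp (T ∷ []) U → Tm [] (neg ⟦ U ⟧) → Tm [] (neg ⟦ T ⟧)
  letCont B k = lam (app ⟦ B ⟧c (lwk k))

  opArgs : ∀ {T} s → Val [] (gty (par s)) → Comp (enm (ar s) ∷ []) T → Tm [] (neg ⟦ T ⟧) →
           Fin (suc (ar s)) → Tm [] o
  opArgs s V C k zero    = ⟦ V ⟧v
  opArgs s V C k (suc i) = app ⟦ C [ num i ]c ⟧c k

  cps-app-↦ : ∀ {T U} (V : Val [] (T ⇛ U)) W k → app ⟦ capp V W ⟧c k ↦ app (app ⟦ V ⟧v ⟦ W ⟧v) k
  cps-app-↦ V W k = β ⟨≡⟩ cong (λ M → app M k) (cong₂ app (lwk-[]ₗ ⟦ V ⟧v k) (lwk-[]ₗ ⟦ W ⟧v k))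

  cps-ret-↦ : ∀ {T} (V : Val [] T) k → app ⟦ cret V ⟧c k ↦ app k ⟦ V ⟧v
  cps-ret-↦ V k = β ⟨≡⟩ cong (app k) (lwk-[]ₗ ⟦ V ⟧v k)

  cps-let-↦ : ∀ {T U} (C : Comp [] T) (B : Comp (T ∷ []) U) k →
              app ⟦ clet C B ⟧c k ↦ app ⟦ C ⟧c (letCont B k)
  cps-let-↦ C B k = β ⟨≡⟩ cong₂ app (lwk-[]ₗ ⟦ C ⟧c k)
    (cong (λ M → lam (app M (lwk k))) (lwk₁-lexts-lσ₀ ⟦ B ⟧c k))

  cps-case-↦ : ∀ {n T} (V : Val [] (enm n)) (Cs : Fin n → Comp [] T) k →
               app ⟦ ccase V Cs ⟧c k ↦ apps ⟦ V ⟧v (λ i → app ⟦ Cs i ⟧c k)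
  cps-case-↦ V Cs k = β ⟨≡⟩ trans (lsub-apps (lσ₀ k) (lwk ⟦ V ⟧v) _)
    (apps-cong (lwk-[]ₗ ⟦ V ⟧v k) (λ i → cong (λ M → app M k) (lwk-[]ₗ ⟦ Cs i ⟧c k)))

  cps-op-↦ : ∀ {T} s V (C : Comp (enm (ar s) ∷ []) T) k →
             app ⟦ cop s V C ⟧c k ↦ apps (opc s) (opArgs s V C k)
  cps-op-↦ s V C k = β ⟨≡⟩ trans (lsub-apps (lσ₀ k) (app (opc s) (lwk ⟦ V ⟧v)) _)
    (apps-cong (cong (app (opc s)) (lwk-[]ₗ ⟦ V ⟧v k))
      (λ i → cong (λ M → app M k) (trans (lwk-[]ₗ _ k) (sym (⟦[]c⟧ C (num i))))))

  apps-ξ : ∀ {n} {h h' : Tm [] (os n)} {Ms} → h ↦ h' → apps h Ms ↦ apps h' Ms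
  apps-ξ {zero}  s = s
  apps-ξ {suc n} s = apps-ξ {n} (ξ s)

  constk-↦* : ∀ n (M : Tm [] o) (Ms : Fin n → Tm [] o) → apps (constk n M) Ms ↦* M
  constk-↦* zero    M Ms = ε
  constk-↦* (suc n) M Ms =
    apps-ξ {n} β ⟨≡⟩ cong (λ h → apps h (λ i → Ms (suc i)))
                        (trans (lsub-constk n (lσ₀ (Ms zero)) (lwk M))
                               (cong (constk n) (lwk-[]ₗ M (Ms zero))))
    ◅ constk-↦* n M (λ i → Ms (suc i))

  projk-↦* : ∀ n (i : Fin n) (Ms : Fin n → Tm [] o) → apps (projk n i) Ms ↦* Ms i
  projk-↦* (suc n) zero Ms =
    apps-ξ {n} β ⟨≡⟩ cong (λ h → apps h (λ i → Ms (suc i))) (lsub-constk n (lσ₀ (Ms zero)) (var here))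
    ◅ constk-↦* n (Ms zero) (λ i → Ms (suc i))
  projk-↦* (suc n) (suc i) Ms =
    apps-ξ {n} β ⟨≡⟩ cong (λ h → apps h (λ i → Ms (suc i))) (lwk-[]ₗ (projk n i) (Ms zero))
    ◅ projk-↦* n i (λ i → Ms (suc i))

  -- CPS images simulate EPCF reduction

  record StrictJoin (M N : Tm [] o) : Set where
    constructor join
    field
      meet    : Tm [] o
      left    : M ↦* meet
      right   : N ↦* meet
      shorter : steps right < steps left

  ReachesOp : ∀ {T} → Comp [] T → Set
  ReachesOp {T} C =
    ∃ λ s → Σ (Val [] (gty (par s))) λ V → Σ (Comp (enm (ar s) ∷ []) T) λ D → C ⟶* cop s V D

  -- After op-let (possibly under ξ-let) the CPS images have no common reduct, only the
  -- same Böhm tree; but then C' has reached an operation, so this never happens to a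
  -- diverging computation.
  data CPSStep {T} (C C' : Comp [] T) : Set where
    joins    : (∀ k → StrictJoin (app ⟦ C ⟧c k) (app ⟦ C' ⟧c k)) → CPSStep C C'
    inherits : (∀ k → InheritsBT (app ⟦ C ⟧c k) (app ⟦ C' ⟧c k)) → ReachesOp C' → CPSStep C C'

  ξ-let* : ∀ {T U} {C D : Comp [] T} {B : Comp (T ∷ []) U} → C ⟶* D → clet C B ⟶* clet D B
  ξ-let* ε       = ε
  ξ-let* (s ◅ r) = ξ-let s ◅ ξ-let* r

  ⟦exts-σ₀-wk⟧ : ∀ {T U k} (i : Fin k) (B : Comp (T ∷ []) U) →
                 ⟦ subC (exts (σ₀ (num i))) (renC (ext there) B) ⟧c ≡ ⟦ B ⟧c
  ⟦exts-σ₀-wk⟧ {k = k} i B = begin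
    ⟦ subC (exts (σ₀ (num i))) (renC (ext there) B) ⟧c
      ≡⟨ ⟦subC⟧ (lexts (lσ₀ (projk k i))) (exts-SubCPS (σ₀-SubCPS (num i))) (renC (ext there) B) ⟩
    lsub (lexts (lσ₀ (projk k i))) ⟦ renC (ext there) B ⟧c
      ≡⟨ cong (lsub (lexts (lσ₀ (projk k i)))) (⟦renC⟧ (lext there) (ext-RenCPS (λ _ → refl)) B) ⟩
    lsub (lexts (lσ₀ (projk k i))) (lwk₁ ⟦ B ⟧c)
      ≡⟨ lwk₁-lexts-lσ₀ ⟦ B ⟧c (projk k i) ⟩
    ⟦ B ⟧c ∎
    where open ≡-Reasoning

  cps-step : ∀ {T} {C C' : Comp [] T} → C ⟶ C' → CPSStep C C'
  cps-step (β-lam {C = C} {W}) = joins λ k → join _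
    (cps-app-↦ (vlam C) W k ◅ ξ β ⟨≡⟩ cong (λ M → app M k) (sym (⟦[]c⟧ C W)) ◅ ε) ε (s≤s z≤n)
  cps-step (β-fix {V = V} {W}) = joins λ k → join _
    (cps-app-↦ (vfix V) W k ◅ ξ (ξ δY)
      ◅ ξ (ξ β) ⟨≡⟩ cong (λ M → app (app M ⟦ W ⟧v) k) (sym (⟦[]ᵥ⟧ V (vfix V))) ◅ ε)
    (cps-app-↦ (V [ vfix V ]ᵥ) W k ◅ ε) (s≤s (s≤s z≤n))
  cps-step (β-case {i = i} {Cs}) = joins λ k → join _
    (cps-case-↦ (num i) Cs k ◅ projk-↦* _ i _) ε (s≤s z≤n)
  cps-step (β-let {V = V} {B}) = joins λ k → join _
    (cps-let-↦ (cret V) B k ◅ cps-ret-↦ V (letCont B k)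
      ◅ β ⟨≡⟩ cong₂ app (sym (⟦[]c⟧ B V)) (lwk-[]ₗ k ⟦ V ⟧v) ◅ ε) ε (s≤s z≤n)
  cps-step (op-let {s = s} {V} {C} {B}) = inherits
    (λ k → same-head-inheritsBT (symσ s)
      {opArgs s V C (letCont B k)} {opArgs s V (clet C (renC (ext there) B)) k}
      (cps-let-↦ (cop s V C) B k ◅ cps-op-↦ s V C (letCont B k) ◅ ε)
      (cps-op-↦ s V (clet C (renC (ext there) B)) k ◅ ε)
      λ { zero → λ h → h
        ; (suc i) → joinable-inheritsBT ε
            (cps-let-↦ (C [ num i ]c) _ k
               ⟨≡⟩ cong (λ M → app ⟦ C [ num i ]c ⟧c (lam (app M (lwk k)))) (⟦exts-σ₀-wk⟧ i B) ◅ ε) })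
    (s , V , _ , ε)
  cps-step (ξ-let {C = C} {C'} {B} st) with cps-step st
  ... | joins J = joins λ k → let join X r r' lt = J (letCont B k) in
          join X (cps-let-↦ C B k ◅ r) (cps-let-↦ C' B k ◅ r') (s≤s lt)
  ... | inherits I (s , V , D , r) = inherits
          (λ k → inheritsBT-trans (joinable-inheritsBT (cps-let-↦ C B k ◅ ε) ε)
                   (inheritsBT-trans (I (letCont B k)) (joinable-inheritsBT ε (cps-let-↦ C' B k ◅ ε))))
          (s , V , _ , ξ-let* r ◅◅ op-let ◅ ε)

  inheritsBT-⟶ : ∀ {T} {C C' : Comp [] T} → C ⟶ C' →
                 ∀ k → InheritsBT (app ⟦ C ⟧c k) (app ⟦ C' ⟧c k)
  inheritsBT-⟶ st k with cps-step st
  ... | joins J      = let join _ r r' _ = J k in joinable-inheritsBT r r'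
  ... | inherits I _ = I k

  inheritsBT-⟶* : ∀ {T} {C C' : Comp [] T} → C ⟶* C' →
                  ∀ k → InheritsBT (app ⟦ C ⟧c k) (app ⟦ C' ⟧c k)
  inheritsBT-⟶* ε        k h = h
  inheritsBT-⟶* (st ◅ r) k   = inheritsBT-trans (inheritsBT-⟶ st k) (inheritsBT-⟶* r k)

  progress : ∀ {T} (C : Comp [] T) → Terminal C ⊎ ∃ (C ⟶_)
  progress (capp (vvar ()) W)
  progress (capp (vlam C) W) = inj₂ (_ , β-lam)
  progress (capp (vfix V) W) = inj₂ (_ , β-fix)
  progress (cret V)          = inj₁ (t-ret V)
  progress (clet C B) with progress C
  ... | inj₁ (t-ret V)    = inj₂ (_ , β-let)
  ... | inj₁ (t-op s V D) = inj₂ (_ , op-let)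
  ... | inj₂ (C' , st)    = inj₂ (_ , ξ-let st)
  progress (ccase (vvar ()) Cs)
  progress (ccase (num i) Cs) = inj₂ (_ , β-case)
  progress (cop s V C)        = inj₁ (t-op s V C)

  diverges-⟶ : ∀ {T} {C C' : Comp [] T} → C ⟶ C' → Diverges C → Diverges C'
  diverges-⟶ st d D r = d D (st ◅ r)

  diverges⇒noHNF : ∀ {T} {C : Comp [] T} → Diverges C → ∀ k → NoHNF (app ⟦ C ⟧c k)
  diverges⇒noHNF d k H r h = go d r (<-wellFounded (steps r))
    where
    go : ∀ {C} → Diverges C → (r : app ⟦ C ⟧c k ↦* H) → Acc _<_ (steps r) → ⊥
    go {C} d r (acc shorter) with progress C
    ... | inj₁ t = d C ε t
    ... | inj₂ (C' , st) with cps-step st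
    ...   | inherits _ (s , V , D , r') = d _ (st ◅ r') (t-op s V D)
    ...   | joins J with J k
    ...     | join _ r₁ r₂ lt with WH.remainder r r₁ (hnf-normal h)
    ...       | r₃ , eq = go (diverges-⟶ st d) (r₂ ◅◅ r₃)
                  (shorter (subst₂ _<_ (sym (steps-◅◅ r₂ r₃)) eq (+-monoˡ-< (steps r₃) lt)))

  module BelowOp {T} {C : Comp [] T} {s : Op} {v : Fin (nval (par s))} {C' : Comp (enm (ar s) ∷ []) T}
                 (r₀ : C ⟶* cop s (vcon (par s) v) C') where

    reached : ∀ {D} → C ⟶* D → Terminal D → D ≡ cop s (vcon (par s) v) C'
    reached r t = terminal-unique r r₀ t (t-op _ _ _)

    not-diverging : ¬ Diverges C
    not-diverging d = d _ r₀ (t-op _ _ _)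

    not-returning : ∀ {V} → ¬ C ⟶* cret V
    not-returning r with reached r (t-ret _)
    ... | ()

    param-label : ∀ {ℓ} → ETAt C (0 ∷ []) ℓ → ℓ ≡ symℓ (symv (par s) v)
    param-label (et-bot↓ d)  = ⊥-elim (not-diverging d)
    param-label (et-ret↓ r)  = ⊥-elim (not-returning r)
    param-label (et-param r) with reached r (t-op _ _ _)
    ... | refl = refl
    param-label (et-out r ())

    below-param-label : ∀ {j q ℓ} → ETAt C (0 ∷ j ∷ q) ℓ → ℓ ≡ none
    below-param-label (et-bot↓ _)   = refl
    below-param-label (et-ret↓ _)   = refl
    below-param-label (et-param↓ _) = refl
    below-param-label (et-out _ _)  = refl

    outside-label : ∀ {i q ℓ} → suc (ar s) ≤ i → ETAt C (i ∷ q) ℓ → ℓ ≡ none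
    outside-label _  (et-bot↓ _)   = refl
    outside-label _  (et-ret↓ _)   = refl
    outside-label () (et-param _)
    outside-label _  (et-param↓ _) = refl
    outside-label le (et-child r j _) with reached r (t-op _ _ _)
    ... | refl = ⊥-elim (<⇒≱ (s≤s (toℕ<n j)) le)
    outside-label _  (et-out _ _)  = refl

    child-label : ∀ j {i q ℓ} → i ≡ suc (toℕ j) → ETAt C (i ∷ q) ℓ → ETAt (C' [ num j ]c) q ℓ
    child-label j _  (et-bot↓ d) = ⊥-elim (not-diverging d)
    child-label j _  (et-ret↓ r) = ⊥-elim (not-returning r)
    child-label j () (et-param _)
    child-label j () (et-param↓ _)
    child-label j eq (et-child r j' h) with reached r (t-op _ _ _)
    ... | refl with toℕ-injective (cong pred eq)
    ...   | refl = h
    child-label j eq (et-out r le) with reached r (t-op _ _ _)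
    ... | refl = ⊥-elim (<⇒≱ (s≤s (toℕ<n j)) (subst (suc (ar s) ≤_) eq le))

  module _ {X Y : Set} (t : Tree X) (g : X → Tree Y) where

    bind-⊥[] : t [] ≡ ⊥ℓ → bind t g [] ≡ ⊥ℓ
    bind-⊥[] eq rewrite eq = refl

    bind-⊥∷ : ∀ {i p} → t [] ≡ ⊥ℓ → bind t g (i ∷ p) ≡ none
    bind-⊥∷ eq rewrite eq = refl

    bind-ret : ∀ {x} → t [] ≡ retℓ x → ∀ p → bind t g p ≡ g x p
    bind-ret eq []      rewrite eq = refl
    bind-ret eq (i ∷ p) rewrite eq = refl

    bind-sym[] : ∀ {f} → t [] ≡ symℓ f → bind t g [] ≡ symℓ f
    bind-sym[] eq rewrite eq = refl

    bind-sym∷ : ∀ {f i p} → t [] ≡ symℓ f → bind t g (i ∷ p) ≡ bind (λ q → t (i ∷ q)) g p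
    bind-sym∷ eq rewrite eq = refl

    bind-none : t [] ≡ none → ∀ p → bind t g p ≡ none
    bind-none eq []      rewrite eq = refl
    bind-none eq (i ∷ p) rewrite eq = refl

  -- Böhm trees of CPS images

  relabel : ∀ {M p ℓ ℓ'} → ℓ ≡ ℓ' → BTAt M p ℓ' → BTAt M p ℓ
  relabel eq = subst (BTAt _ _) (sym eq)

  bt-noHNF : ∀ {X M} p (t : Tree X) (g : X → Tree ⊥) → t [] ≡ ⊥ℓ → NoHNF M → BTAt M p (bind t g p)
  bt-noHNF []      t g eq nh = relabel (bind-⊥[] t g eq) (bt-bot nh)
  bt-noHNF (_ ∷ _) t g eq nh = relabel (bind-⊥∷ t g eq) (bt-bot↓ nh)

  module _ {T} (k : Tm [] (neg ⟦ T ⟧)) (b : Val [] T → Tree ⊥)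
           (isb : ∀ V → IsBT (app k ⟦ V ⟧v) (b V)) where

    bt-cps : ∀ p (C : Comp [] T) e → IsET C e → BTAt (app ⟦ C ⟧c k) p (bind e b p)

    bt-op : ∀ p {C : Comp [] T} {s v C'} e → C ⟶* cop s (vcon (par s) v) C' →
            e [] ≡ symℓ (symσ s) → IsET C e →
            BTAt (apps (opc s) (opArgs s (vcon (par s) v) C' k)) p (bind e b p)
    bt-op [] {s = s} {v} {C'} e r eq ise =
      relabel (bind-sym[] e b eq) (bt-head {Ms = opArgs s (vcon (par s) v) C' k} ε)
    bt-op (i ∷ q) {s = s} {v} {C'} e r eq ise =
      relabel (bind-sym∷ e b eq) (child (inRange (suc (ar s)) i) q)
      where
      open BelowOp r

      args : Fin (suc (ar s)) → Tm [] o
      args = opArgs s (vcon (par s) v) C' k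

      below : ℕ → Tree (Val [] T)
      below i q = e (i ∷ q)

      child : ∀ {i} → InRange (suc (ar s)) i → ∀ q → BTAt (apps (opc s) args) (i ∷ q) (bind (below i) b q)
      child (inside zero) [] = bt-child {Ms = args} ε zero
        (relabel (bind-sym[] (below 0) b (param-label (ise (0 ∷ [])))) (bt-head {Ms = λ ()} ε))
      child (inside zero) (j ∷ q) = bt-child {Ms = args} ε zero
        (relabel (trans (bind-sym∷ (below 0) b (param-label (ise (0 ∷ []))))
                        (bind-none _ b (below-param-label (ise (0 ∷ j ∷ []))) q))
                 (bt-out {Ms = λ ()} ε z≤n))
      child (inside (suc j)) q = bt-child {Ms = args} ε (suc j)
        (bt-cps q (C' [ num j ]c) _ λ q' → child-label j refl (ise (suc (toℕ j) ∷ q')))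
      child (outside le) q =
        relabel (bind-none _ b (outside-label le (ise (_ ∷ []))) q) (bt-out {Ms = args} ε le)

    bt-cps p C e ise with e [] in eq | ise []
    ... | _ | et-bot d       = bt-noHNF p e b eq (diverges⇒noHNF d k)
    ... | _ | et-ret {V} r   = relabel (bind-ret e b eq p)
      (inheritsBT-⟶* r k (joinable-inheritsBT (cps-ret-↦ V k ◅ ε) ε (isb V p)))
    ... | _ | et-op {s} {v} {C'} r = inheritsBT-⟶* r k
      (joinable-inheritsBT (cps-op-↦ s (vcon (par s) v) C' k ◅ ε) ε (bt-op p e r eq ise))

theorem5p5 : (S : Sig) → let open Theory S in
    ∀ {T : Ty} (C : Comp [] T) (c : Tm [] (⟦ T ⟧ ⇒ o))
      (e : Tree (Val [] T)) (b : Val [] T → Tree ⊥) →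
      IsET C e →
      (∀ V → IsBT (app c ⟦ V ⟧v) (b V)) →
      IsBT (app ⟦ C ⟧c c) (bind e b)
theorem5p5 S C c e b ise isb p = CPSCorrectness.bt-cps S c b isb p C e ise
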